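{- Let $R$ be a finite ring, $A\subseteq R$, and let $\bar A$ denote the image of $A$ in $R/J(R)$. Then: (i) $A$ is a maximal independent set of $\Gamma(R)$ if and only if $\bar A$ is a maximal independent set of $\Gamma(R/J(R))$ and $A=A+J(R)$; (ii) $\bar A$ is a maximal independent set of $\Gamma(R/J(R))$ if and only if $A+J(R)$ is a maximal independent set of $\Gamma(R)$. In particular, $\Gamma(R)$ is well-covered if and only if $\Gamma(R/J(R))$ is well-covered.
   Context: Rings are finite, associative, with nonzero identity; $J(R)$ is the Jacobson radical. The unitary Cayley graph $\Gamma(R)$ has vertex set $R$, with distinct $x,y$ adjacent iff $x-y$ is a unit. A graph is well-covered if all its maximal independent sets have the same size. -}

module Defs where

open import Level using (0ℓ)
open import Data.Nat using (ℕ)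
open import Data.Fin using (Fin)
open import Data.Fin.Properties using (_≟_; any?)
open import Data.Fin.Subset using (Subset; _∈_; _∉_; _⊆_; ∣_∣; Side)
open import Data.Fin.Subset.Properties using (_∈?_)
open import Data.Vec using (tabulate)
open import Data.Product using (_×_; ∃; _,_)
open import Data.Empty using (⊥)
open import Relation.Nullary using (¬_; does)
open import Relation.Nullary.Decidable using (_×-dec_)
open import Relation.Binary.PropositionalEquality using (_≡_; _≢_)
open import Algebra.Core using (Op₁; Op₂)
open import Algebra.Structures using (IsRing)
open import Algebra.Bundles.Raw using (RawRing)
open import Algebra.Morphism.Structures using (module RingMorphisms)

-- A finite ring with nonzero identity.  Every finite ring is isomorphic
-- to one whose carrier is Fin n (n = |R|), with propositional equality.
record FiniteRing (n : ℕ) : Set where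
  infixl 7 _*_
  infixl 6 _+_
  infix  8 -_
  field
    _+_ _*_ : Op₂ (Fin n)
    -_      : Op₁ (Fin n)
    0# 1#   : Fin n
    isRing  : IsRing _≡_ _+_ _*_ -_ 0# 1#
    1≢0     : 1# ≢ 0#

  rawRing : RawRing 0ℓ 0ℓ
  rawRing = record
    { Carrier = Fin n ; _≈_ = _≡_ ; _+_ = _+_ ; _*_ = _*_
    ; -_ = -_ ; 0# = 0# ; 1# = 1# }

  _-_ : Op₂ (Fin n)
  x - y = x + (- y)

module _ {n : ℕ} (R : FiniteRing n) where
  open FiniteRing R

  IsUnit : Fin n → Set
  IsUnit u = ∃ λ v → (u * v ≡ 1#) × (v * u ≡ 1#)

  IsLeftIdeal : Subset n → Set
  IsLeftIdeal I =
    (0# ∈ I)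
    × (∀ x y → x ∈ I → y ∈ I → (x + y) ∈ I)
    × (∀ x → x ∈ I → (- x) ∈ I)
    × (∀ r x → x ∈ I → (r * x) ∈ I)

  IsProperLeftIdeal : Subset n → Set
  IsProperLeftIdeal I = IsLeftIdeal I × (1# ∉ I)

  IsMaximalLeftIdeal : Subset n → Set
  IsMaximalLeftIdeal I =
    IsProperLeftIdeal I × (∀ K → IsProperLeftIdeal K → I ⊆ K → K ⊆ I)

  InJacobson : Fin n → Set
  InJacobson x = ∀ I → IsMaximalLeftIdeal I → x ∈ I

  IsJacobsonRadical : Subset n → Set
  IsJacobsonRadical J = ∀ x → (x ∈ J → InJacobson x) × (InJacobson x → x ∈ J)

  Adjacent : Fin n → Fin n → Set
  Adjacent x y = (x ≢ y) × IsUnit (x - y)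

  Independent : Subset n → Set
  Independent A = ∀ x y → x ∈ A → y ∈ A → ¬ Adjacent x y

  MaximalIndependent : Subset n → Set
  MaximalIndependent A =
    Independent A × (∀ B → Independent B → A ⊆ B → B ⊆ A)

  WellCovered : Set
  WellCovered = ∀ A B → MaximalIndependent A → MaximalIndependent B → ∣ A ∣ ≡ ∣ B ∣

  _⊕_ : Subset n → Subset n → Subset n
  A ⊕ J = tabulate λ x →
    does (any? λ a → any? λ j → (a ∈? A) ×-dec ((j ∈? J) ×-dec (x ≟ (a + j))))

image : ∀ {n m} → (Fin n → Fin m) → Subset n → Subset m
image π A = tabulate λ y → does (any? λ a → (a ∈? A) ×-dec (π a ≟ y))

IsRingHom : ∀ {n m} (R : FiniteRing n) (S : FiniteRing m) → (Fin n → Fin m) → Set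
IsRingHom R S π = RingMorphisms.IsRingHomomorphism (FiniteRing.rawRing R) (FiniteRing.rawRing S) π

-- (S , π) is the quotient R/J(R) with canonical projection π:
-- π is a surjective ring homomorphism with kernel J (first isomorphism theorem)
IsQuotientBy : ∀ {n m} (R : FiniteRing n) (S : FiniteRing m) → (Fin n → Fin m) → Subset n → Set
IsQuotientBy R S π J =
  IsRingHom R S π
  × (∀ y → ∃ λ x → π x ≡ y)
  × (∀ x → (π x ≡ FiniteRing.0# S → x ∈ J) × (x ∈ J → π x ≡ FiniteRing.0# S))

{-# OPTIONS --safe #-}

-- Elements of 1 + J(R) are units, so x - y is a unit in R exactly when its image in
-- R/J(R) is one: x and y are adjacent in Γ(R) iff their images are adjacent in
-- Γ(R/J(R)).  Thus Γ(R) is Γ(R/J(R)) with every vertex blown up to an independent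
-- coset of J(R).  Taking preimages is then a bijection between maximal independent
-- sets of Γ(R/J(R)) and those of Γ(R), whose inverse is taking images; the maximal
-- independent sets of Γ(R) are unions of cosets, and the preimage of a set B has
-- exactly |J(R)| · |B| elements.

module Submission where

open import Defs
open import Level using (0ℓ)
open import Data.Nat.Base as ℕ using (ℕ; zero; suc; NonZero; ≢-nonZero)
import Data.Nat.Properties as ℕₚ
open import Data.Fin.Base using (Fin; zero; suc)
open import Data.Fin.Properties using (_≟_; any?; all?)
open import Data.Fin.Permutation using (Permutation; permutation)
open import Data.Fin.Subset using (Subset; _∈_; _⊆_; ∣_∣)
open import Data.Fin.Subset.Properties
  using (_∈?_; _⊂?_; ⊆-antisym; anySubset?; p⊂q⇒∣p∣<∣q∣; ∣p∣≤n)
open import Data.Vec.Base using ([]; _∷_; tabulate; lookup)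
open import Data.Vec.Properties using (lookup∘tabulate; []=⇒lookup; lookup⇒[]=)
open import Data.Bool.Base using (Bool; true; false)
open import Data.Empty using (⊥-elim)
open import Data.Product using (_×_; ∃; ∃₂; _,_; proj₁; proj₂; map₂)
open import Function.Base using (_∘_; id)
open import Function.Bundles using (_⇔_; mk⇔; Equivalence)
open import Relation.Unary using (Decidable)
open import Relation.Nullary using (yes; no; does; ¬?; contradiction)
open import Relation.Nullary.Decidable using (_×-dec_; _→-dec_; dec-true; does-⇔)
open import Relation.Binary.PropositionalEquality
open import Algebra.Bundles using (Ring)
open import Algebra.Structures using (IsRing)
import Algebra.Properties.Ring as RingProperties
open import Algebra.Morphism.Structures using (module RingMorphisms)
open import Algebra.Properties.Semiring.Sum ℕₚ.+-*-semiring
  using (sum; sum-cong-≗; sum-replicate-zero; ∑-comm; ∑-permute; *-distribˡ-sum; *-distribʳ-sum)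

open Equivalence using (to; from)

∈-tabulate⁻ : ∀ {k} {P : Fin k → Set} (P? : Decidable P) {x} →
              x ∈ tabulate (does ∘ P?) → P x
∈-tabulate⁻ P? {x} x∈
  with P? x | trans (sym (lookup∘tabulate (does ∘ P?) x)) ([]=⇒lookup x∈)
... | yes p | _ = p
... | no _  | ()

∈-tabulate⁺ : ∀ {k} {P : Fin k → Set} (P? : Decidable P) {x} →
              P x → x ∈ tabulate (does ∘ P?)
∈-tabulate⁺ P? {x} p =
  lookup⇒[]= x _ (trans (lookup∘tabulate (does ∘ P?) x) (dec-true (P? x) p))

preimage : ∀ {n m} → (Fin n → Fin m) → Subset m → Subset n
preimage π B = tabulate (lookup B ∘ π)

module ImageProperties {n m} (π : Fin n → Fin m) where

  ∈-image⁻ : ∀ {A y} → y ∈ image π A → ∃ λ x → x ∈ A × π x ≡ y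
  ∈-image⁻ {A} = ∈-tabulate⁻ (λ y → any? λ x → (x ∈? A) ×-dec (π x ≟ y))

  ∈-image⁺ : ∀ {A x} → x ∈ A → π x ∈ image π A
  ∈-image⁺ {A} x∈A =
    ∈-tabulate⁺ (λ y → any? λ x → (x ∈? A) ×-dec (π x ≟ y)) (_ , x∈A , refl)

  ∈-preimage⁻ : ∀ {B x} → x ∈ preimage π B → π x ∈ B
  ∈-preimage⁻ {B} {x} x∈ =
    lookup⇒[]= (π x) B (trans (sym (lookup∘tabulate (lookup B ∘ π) x)) ([]=⇒lookup x∈))

  ∈-preimage⁺ : ∀ {B x} → π x ∈ B → x ∈ preimage π B
  ∈-preimage⁺ {B} {x} πx∈B =
    lookup⇒[]= x _ (trans (lookup∘tabulate (lookup B ∘ π) x) ([]=⇒lookup πx∈B))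

χ : Bool → ℕ
χ true  = 1
χ false = 0

∣p∣≡∑χ : ∀ {k} (p : Subset k) → ∣ p ∣ ≡ sum (χ ∘ lookup p)
∣p∣≡∑χ []          = refl
∣p∣≡∑χ (true ∷ p)  = cong suc (∣p∣≡∑χ p)
∣p∣≡∑χ (false ∷ p) = ∣p∣≡∑χ p

∑χ≟*≡ : ∀ {k} (z : Fin k) (f : Fin k → ℕ) → sum (λ y → χ (does (z ≟ y)) ℕ.* f y) ≡ f z
∑χ≟*≡ {suc k} zero f =
  trans (cong₂ ℕ._+_ (ℕₚ.*-identityˡ (f zero)) (sum-replicate-zero k))
        (ℕₚ.+-identityʳ (f zero))
∑χ≟*≡ (suc z) f = ∑χ≟*≡ z (f ∘ suc)

∑≡0⇒≡0 : ∀ {k} (f : Fin k → ℕ) i → sum f ≡ 0 → f i ≡ 0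
∑≡0⇒≡0 f zero    = ℕₚ.m+n≡0⇒m≡0 (f zero)
∑≡0⇒≡0 f (suc i) = ∑≡0⇒≡0 (f ∘ suc) i ∘ ℕₚ.m+n≡0⇒n≡0 (f zero)

fibre : ∀ {n m} → (Fin n → Fin m) → Fin m → ℕ
fibre π y = sum λ x → χ (does (π x ≟ y))

∣preimage∣≡∑fibre : ∀ {n m} (π : Fin n → Fin m) B →
                    ∣ preimage π B ∣ ≡ sum (λ y → fibre π y ℕ.* χ (lookup B y))
∣preimage∣≡∑fibre π B = begin
  ∣ preimage π B ∣
    ≡⟨ ∣p∣≡∑χ (preimage π B) ⟩
  sum (λ x → χ (lookup (preimage π B) x))
    ≡⟨ sum-cong-≗ (λ x → cong χ (lookup∘tabulate (lookup B ∘ π) x)) ⟩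
  sum (λ x → χ (lookup B (π x)))
    ≡⟨ sum-cong-≗ (λ x → sym (∑χ≟*≡ (π x) (χ ∘ lookup B))) ⟩
  sum (λ x → sum (λ y → χ (does (π x ≟ y)) ℕ.* χ (lookup B y)))
    ≡⟨ ∑-comm (λ x y → χ (does (π x ≟ y)) ℕ.* χ (lookup B y)) ⟩
  sum (λ y → sum (λ x → χ (does (π x ≟ y)) ℕ.* χ (lookup B y)))
    ≡⟨ sum-cong-≗ (λ y → sym (*-distribʳ-sum (χ (lookup B y)) λ x → χ (does (π x ≟ y)))) ⟩
  sum (λ y → fibre π y ℕ.* χ (lookup B y)) ∎
  where open ≡-Reasoning

ring : ∀ {k} → FiniteRing k → Ring 0ℓ 0ℓ
ring R = record { isRing = FiniteRing.isRing R }

module FiniteRingProperties {k} (R : FiniteRing k) where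

  open FiniteRing R
  open IsRing isRing
    using (*-assoc; *-identityˡ; *-identityʳ; distribˡ; distribʳ; zeroˡ; -‿inverseʳ)
  open RingProperties (ring R) using (//-rightDividesˡ; //-rightDividesʳ; -‿distribˡ-*)

  leftInverse≡rightInverse : ∀ {l x r} → l * x ≡ 1# → x * r ≡ 1# → l ≡ r
  leftInverse≡rightInverse {l} {x} {r} l*x≡1 x*r≡1 = begin
    l            ≡⟨ sym (*-identityʳ l) ⟩
    l * 1#       ≡⟨ cong (l *_) (sym x*r≡1) ⟩
    l * (x * r)  ≡⟨ sym (*-assoc l x r) ⟩
    (l * x) * r  ≡⟨ cong (_* r) l*x≡1 ⟩
    1# * r       ≡⟨ *-identityˡ r ⟩
    r            ∎
    where open ≡-Reasoning

  invertible⇒isUnit : ∀ {l x r} → l * x ≡ 1# → x * r ≡ 1# → IsUnit R x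
  invertible⇒isUnit {x = x} {r} l*x≡1 x*r≡1 =
    r , x*r≡1 , subst (λ l → l * x ≡ 1#) (leftInverse≡rightInverse l*x≡1 x*r≡1) l*x≡1

  isUnit⇒adjacent : ∀ {x y} → IsUnit R (x - y) → Adjacent R x y
  isUnit⇒adjacent {x} {y} x-y-isUnit@(v , x-y*v≡1 , _) = x≢y , x-y-isUnit
    where
    open ≡-Reasoning

    x≢y : x ≢ y
    x≢y x≡y = 1≢0 (begin
      1#           ≡⟨ sym x-y*v≡1 ⟩
      (x - y) * v  ≡⟨ cong (λ z → (x - z) * v) (sym x≡y) ⟩
      (x - x) * v  ≡⟨ cong (_* v) (-‿inverseʳ x) ⟩
      0# * v       ≡⟨ zeroˡ v ⟩
      0#           ∎)

  +ʳ-permutation : Fin k → Permutation k k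
  +ʳ-permutation a = permutation (_+ a) (_- a) (//-rightDividesˡ a) (//-rightDividesʳ a)

  ∈-⊕⁻ : ∀ {A K x} → x ∈ _⊕_ R A K → ∃₂ λ a j → a ∈ A × j ∈ K × x ≡ a + j
  ∈-⊕⁻ {A} {K} =
    ∈-tabulate⁻ λ x → any? λ a → any? λ j → (a ∈? A) ×-dec ((j ∈? K) ×-dec (x ≟ a + j))

  ∈-⊕⁺ : ∀ {A K a j} → a ∈ A → j ∈ K → (a + j) ∈ _⊕_ R A K
  ∈-⊕⁺ {A} {K} a∈A j∈K =
    ∈-tabulate⁺ (λ x → any? λ a → any? λ j → (a ∈? A) ×-dec ((j ∈? K) ×-dec (x ≟ a + j)))
                (_ , _ , a∈A , j∈K , refl)

  isProperLeftIdeal? : Decidable (IsProperLeftIdeal R)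
  isProperLeftIdeal? I =
    ((0# ∈? I)
      ×-dec (all? λ x → all? λ y → (x ∈? I) →-dec ((y ∈? I) →-dec ((x + y) ∈? I)))
      ×-dec (all? λ x → (x ∈? I) →-dec ((- x) ∈? I))
      ×-dec (all? λ r → all? λ x → (x ∈? I) →-dec ((r * x) ∈? I)))
    ×-dec ¬? (1# ∈? I)

  -- Every strict enlargement of I uses up one unit of fuel, and k ≤ ∣ I ∣ + fuel survives it.
  extendToMaximal : ∀ fuel I → k ℕ.≤ ∣ I ∣ ℕ.+ fuel → IsProperLeftIdeal R I →
                    ∃ λ M → IsMaximalLeftIdeal R M × I ⊆ M
  extendToMaximal fuel I k≤∣I∣+fuel I-proper
    with anySubset? (λ K → isProperLeftIdeal? K ×-dec (I ⊂? K))
  ... | no ∄K = I , (I-proper , I-maximal) , id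
    where
    I-maximal : ∀ K → IsProperLeftIdeal R K → I ⊆ K → K ⊆ I
    I-maximal K K-proper I⊆K {x} x∈K with x ∈? I
    ... | yes x∈I = x∈I
    ... | no  x∉I = ⊥-elim (∄K (K , K-proper , I⊆K , x , x∈K , x∉I))
  ... | yes (K , K-proper , I⊂K) with fuel
  ...   | zero = contradiction
                   (ℕₚ.<-≤-trans (p⊂q⇒∣p∣<∣q∣ I⊂K) (∣p∣≤n K))
                   (ℕₚ.≤⇒≯ (subst (k ℕ.≤_) (ℕₚ.+-identityʳ ∣ I ∣) k≤∣I∣+fuel))
  ...   | suc fuel′ =
    map₂ (map₂ (λ K⊆M x∈I → K⊆M (proj₁ I⊂K x∈I)))
         (extendToMaximal fuel′ K k≤∣K∣+fuel′ K-proper)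
    where
    k≤∣K∣+fuel′ : k ℕ.≤ ∣ K ∣ ℕ.+ fuel′
    k≤∣K∣+fuel′ = begin
      k                    ≤⟨ k≤∣I∣+fuel ⟩
      ∣ I ∣ ℕ.+ suc fuel′  ≡⟨ ℕₚ.+-suc ∣ I ∣ fuel′ ⟩
      suc ∣ I ∣ ℕ.+ fuel′  ≤⟨ ℕₚ.+-monoˡ-≤ fuel′ (p⊂q⇒∣p∣<∣q∣ I⊂K) ⟩
      ∣ K ∣ ℕ.+ fuel′      ∎
      where open ℕₚ.≤-Reasoning

  ⊆-maximalLeftIdeal : ∀ I → IsProperLeftIdeal R I → ∃ λ M → IsMaximalLeftIdeal R M × I ⊆ M
  ⊆-maximalLeftIdeal I = extendToMaximal k I (ℕₚ.m≤n+m k ∣ I ∣)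

  leftMultiples : Fin k → Subset k
  leftMultiples e = tabulate λ x → does (any? λ r → x ≟ r * e)

  ∈-leftMultiples⁻ : ∀ {e x} → x ∈ leftMultiples e → ∃ λ r → x ≡ r * e
  ∈-leftMultiples⁻ {e} = ∈-tabulate⁻ λ x → any? λ r → x ≟ r * e

  ∈-leftMultiples⁺ : ∀ {e} r → (r * e) ∈ leftMultiples e
  ∈-leftMultiples⁺ {e} r = ∈-tabulate⁺ (λ x → any? λ r → x ≟ r * e) (r , refl)

  leftMultiples-isLeftIdeal : ∀ e → IsLeftIdeal R (leftMultiples e)
  leftMultiples-isLeftIdeal e = 0∈Re , +-closed , -‿closed , *-closed
    where
    Re = leftMultiples e

    0∈Re : 0# ∈ Re
    0∈Re = subst (_∈ Re) (zeroˡ e) (∈-leftMultiples⁺ 0#)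

    +-closed : ∀ x y → x ∈ Re → y ∈ Re → (x + y) ∈ Re
    +-closed _ _ x∈Re y∈Re with ∈-leftMultiples⁻ x∈Re | ∈-leftMultiples⁻ y∈Re
    ... | r , refl | s , refl = subst (_∈ Re) (distribʳ e r s) (∈-leftMultiples⁺ (r + s))

    -‿closed : ∀ x → x ∈ Re → (- x) ∈ Re
    -‿closed _ x∈Re with ∈-leftMultiples⁻ x∈Re
    ... | r , refl = subst (_∈ Re) (sym (-‿distribˡ-* r e)) (∈-leftMultiples⁺ (- r))

    *-closed : ∀ r x → x ∈ Re → (r * x) ∈ Re
    *-closed r _ x∈Re with ∈-leftMultiples⁻ x∈Re
    ... | s , refl = subst (_∈ Re) (*-assoc r s e) (∈-leftMultiples⁺ (r * s))

  InJacobson-*ˡ : ∀ r {x} → InJacobson R x → InJacobson R (r * x)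
  InJacobson-*ˡ r x∈J I I-max@(((_ , _ , _ , *-closed) , _) , _) = *-closed r _ (x∈J I I-max)

  InJacobson-‿ : ∀ {x} → InJacobson R x → InJacobson R (- x)
  InJacobson-‿ x∈J I I-max@(((_ , _ , -‿closed , _) , _) , _) = -‿closed _ (x∈J I I-max)

  1+j-leftInvertible : ∀ {j} → InJacobson R j → ∃ λ u → u * (1# + j) ≡ 1#
  1+j-leftInvertible {j} j∈J with 1# ∈? leftMultiples (1# + j)
  ... | yes 1∈Re = map₂ sym (∈-leftMultiples⁻ 1∈Re)
  ... | no 1∉Re
    with ⊆-maximalLeftIdeal (leftMultiples (1# + j)) (leftMultiples-isLeftIdeal (1# + j) , 1∉Re)
  ...   | M , M-max@(((_ , +-closed , -‿closed , _) , 1∉M) , _) , Re⊆M = contradiction 1∈M 1∉M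
    where
    1+j∈M : (1# + j) ∈ M
    1+j∈M = Re⊆M (subst (_∈ leftMultiples (1# + j)) (*-identityˡ (1# + j)) (∈-leftMultiples⁺ 1#))

    1∈M : 1# ∈ M
    1∈M = subst (_∈ M) (//-rightDividesʳ j 1#)
                (+-closed _ _ 1+j∈M (-‿closed j (j∈J M M-max)))

  1+j-isUnit : ∀ {j} → InJacobson R j → IsUnit R (1# + j)
  1+j-isUnit {j} j∈J with 1+j-leftInvertible j∈J
  ... | u , u*[1+j]≡1 = u , [1+j]*u≡1 , u*[1+j]≡1
    where
    open ≡-Reasoning

    -- u = 1 - u j is again of the form 1 + J(R), so it has a left inverse w, and then w = 1 + j.
    u≡1-uj : u ≡ 1# - (u * j)
    u≡1-uj = begin
      u                           ≡⟨ sym (//-rightDividesʳ (u * j) u) ⟩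
      (u + u * j) - (u * j)       ≡⟨ cong (λ z → (z + u * j) - (u * j)) (sym (*-identityʳ u)) ⟩
      (u * 1# + u * j) - (u * j)  ≡⟨ cong (_- (u * j)) (sym (distribˡ u 1# j)) ⟩
      (u * (1# + j)) - (u * j)    ≡⟨ cong (_- (u * j)) u*[1+j]≡1 ⟩
      1# - (u * j)                ∎

    w*u≡1 : ∃ λ w → w * u ≡ 1#
    w*u≡1 = map₂ (λ w*[1-uj]≡1 → trans (cong (_ *_) u≡1-uj) w*[1-uj]≡1)
                 (1+j-leftInvertible (InJacobson-‿ (InJacobson-*ˡ u j∈J)))

    [1+j]*u≡1 : (1# + j) * u ≡ 1#
    [1+j]*u≡1 = subst (λ w → w * u ≡ 1#)
                      (leftInverse≡rightInverse (proj₂ w*u≡1) u*[1+j]≡1) (proj₂ w*u≡1)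

module SurjectiveHom {n m} (R : FiniteRing n) (S : FiniteRing m) (π : Fin n → Fin m)
  (π-hom : IsRingHom R S π) (π-surjective : ∀ y → ∃ λ x → π x ≡ y) where

  open FiniteRing R
  open FiniteRingProperties R
  open IsRing isRing using (*-assoc)
  open RingProperties (ring R) using (\\-leftDividesˡ)
  open RingMorphisms (FiniteRing.rawRing R) (FiniteRing.rawRing S)
    using (module IsRingHomomorphism)
  open IsRingHomomorphism π-hom using (+-homo; *-homo; -‿homo; 0#-homo; 1#-homo)
  open ImageProperties π
  open ≡-Reasoning

  private module S where
    open FiniteRing S public
    open IsRing (FiniteRing.isRing S) public using (+-identityˡ; +-identityʳ; -‿inverseˡ)
    open RingProperties (ring S) public using (+-identityˡ-unique)

  π[x-y]≡πx-πy : ∀ x y → π (x - y) ≡ π x S.- π y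
  π[x-y]≡πx-πy x y = trans (+-homo x (- y)) (cong (π x S.+_) (-‿homo y))

  π≡π⇒π[-x+y]≡0 : ∀ {x y} → π x ≡ π y → π (- x + y) ≡ S.0#
  π≡π⇒π[-x+y]≡0 {x} {y} πx≡πy = begin
    π (- x + y)          ≡⟨ +-homo (- x) y ⟩
    π (- x) S.+ π y      ≡⟨ cong (S._+ π y) (-‿homo x) ⟩
    S.- π x S.+ π y      ≡⟨ cong (λ z → S.- z S.+ π y) πx≡πy ⟩
    S.- π y S.+ π y      ≡⟨ S.-‿inverseˡ (π y) ⟩
    S.0#                 ∎

  π[x+a]≡πa⇔πx≡0 : ∀ x a → π (x + a) ≡ π a ⇔ π x ≡ S.0#
  π[x+a]≡πa⇔πx≡0 x a = mk⇔
    (λ π[x+a]≡πa → S.+-identityˡ-unique (π x) (π a) (trans (sym (+-homo x a)) π[x+a]≡πa))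
    (λ πx≡0 → trans (+-homo x a) (trans (cong (S._+ π a) πx≡0) (S.+-identityˡ (π a))))

  ⊕-kernel≡saturation : ∀ {K} → (∀ x → (π x ≡ S.0# → x ∈ K) × (x ∈ K → π x ≡ S.0#)) →
                        ∀ A → _⊕_ R A K ≡ preimage π (image π A)
  ⊕-kernel≡saturation {K} kernel A = ⊆-antisym ⊕⊆saturation saturation⊆⊕
    where
    ⊕⊆saturation : _⊕_ R A K ⊆ preimage π (image π A)
    ⊕⊆saturation x∈A⊕K with ∈-⊕⁻ x∈A⊕K
    ... | a , j , a∈A , j∈K , refl =
      ∈-preimage⁺ (subst (_∈ image π A) (sym π[a+j]≡πa) (∈-image⁺ a∈A))
      where
      π[a+j]≡πa : π (a + j) ≡ π a
      π[a+j]≡πa = begin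
        π (a + j)        ≡⟨ +-homo a j ⟩
        π a S.+ π j      ≡⟨ cong (π a S.+_) (proj₂ (kernel j) j∈K) ⟩
        π a S.+ S.0#     ≡⟨ S.+-identityʳ (π a) ⟩
        π a              ∎

    saturation⊆⊕ : preimage π (image π A) ⊆ _⊕_ R A K
    saturation⊆⊕ {x} x∈saturation with ∈-image⁻ (∈-preimage⁻ x∈saturation)
    ... | a , a∈A , πa≡πx =
      subst (_∈ _⊕_ R A K) (\\-leftDividesˡ a x)
            (∈-⊕⁺ a∈A (proj₁ (kernel (- a + x)) (π≡π⇒π[-x+y]≡0 πa≡πx)))

  isUnit-preserve : ∀ {x} → IsUnit R x → IsUnit S (π x)
  isUnit-preserve (v , x*v≡1 , v*x≡1) = π v , π-preserves-1 x*v≡1 , π-preserves-1 v*x≡1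
    where
    π-preserves-1 : ∀ {a b} → a * b ≡ 1# → π a S.* π b ≡ S.1#
    π-preserves-1 {a} {b} a*b≡1 = trans (sym (*-homo a b)) (trans (cong π a*b≡1) 1#-homo)

  module _ (kernel⊆Jacobson : ∀ {x} → π x ≡ S.0# → InJacobson R x) where

    π≡1⇒isUnit : ∀ {z} → π z ≡ S.1# → IsUnit R z
    π≡1⇒isUnit {z} πz≡1 =
      subst (IsUnit R) (\\-leftDividesˡ 1# z)
        (1+j-isUnit (kernel⊆Jacobson (π≡π⇒π[-x+y]≡0 (trans 1#-homo (sym πz≡1)))))

    isUnit-reflect : ∀ {x} → IsUnit S (π x) → IsUnit R x
    isUnit-reflect {x} (y , πx*y≡1 , y*πx≡1) with π-surjective y
    ... | v , refl
      with π≡1⇒isUnit (trans (*-homo x v) πx*y≡1) | π≡1⇒isUnit (trans (*-homo v x) y*πx≡1)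
    ...   | t , x*v*t≡1 , _ | t′ , _ , t′*v*x≡1 =
      invertible⇒isUnit (trans (*-assoc t′ v x) t′*v*x≡1) (trans (sym (*-assoc x v t)) x*v*t≡1)

    adjacent⇔ : ∀ x y → Adjacent R x y ⇔ Adjacent S (π x) (π y)
    adjacent⇔ x y = mk⇔
      (λ (_ , x-y-isUnit) → FiniteRingProperties.isUnit⇒adjacent S
         (subst (IsUnit S) (π[x-y]≡πx-πy x y) (isUnit-preserve x-y-isUnit)))
      (λ (_ , πx-πy-isUnit) → isUnit⇒adjacent
         (isUnit-reflect (subst (IsUnit S) (sym (π[x-y]≡πx-πy x y)) πx-πy-isUnit)))

  fibre-translate : ∀ y → fibre π y ≡ fibre π S.0#
  fibre-translate y with π-surjective y
  ... | a , refl = begin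
    sum (λ x → χ (does (π x ≟ π a)))        ≡⟨ ∑-permute _ (+ʳ-permutation a) ⟩
    sum (λ x → χ (does (π (x + a) ≟ π a)))  ≡⟨ sum-cong-≗ shift ⟩
    sum (λ x → χ (does (π x ≟ S.0#)))       ∎
    where
    shift : ∀ x → χ (does (π (x + a) ≟ π a)) ≡ χ (does (π x ≟ S.0#))
    shift x = cong χ (does-⇔ (π[x+a]≡πa⇔πx≡0 x a) (π (x + a) ≟ π a) (π x ≟ S.0#))

  fibre-nonZero : NonZero (fibre π S.0#)
  fibre-nonZero = ≢-nonZero λ fibre≡0 →
    ℕₚ.1+n≢0 (trans (sym (cong χ (dec-true (π 0# ≟ S.0#) 0#-homo)))
                     (∑≡0⇒≡0 (λ x → χ (does (π x ≟ S.0#))) 0# fibre≡0))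

  ∣preimage∣ : ∀ B → ∣ preimage π B ∣ ≡ fibre π S.0# ℕ.* ∣ B ∣
  ∣preimage∣ B = begin
    ∣ preimage π B ∣
      ≡⟨ ∣preimage∣≡∑fibre π B ⟩
    sum (λ y → fibre π y ℕ.* χ (lookup B y))
      ≡⟨ sum-cong-≗ (λ y → cong (ℕ._* χ (lookup B y)) (fibre-translate y)) ⟩
    sum (λ y → fibre π S.0# ℕ.* χ (lookup B y))
      ≡⟨ sym (*-distribˡ-sum (fibre π S.0#) (χ ∘ lookup B)) ⟩
    fibre π S.0# ℕ.* sum (χ ∘ lookup B)
      ≡⟨ cong (fibre π S.0# ℕ.*_) (sym (∣p∣≡∑χ B)) ⟩
    fibre π S.0# ℕ.* ∣ B ∣
      ∎

module MaximalIndependentSets {n m} (R : FiniteRing n) (S : FiniteRing m) (π : Fin n → Fin m)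
  (π-surjective : ∀ y → ∃ λ x → π x ≡ y)
  (adjacent⇔ : ∀ x y → Adjacent R x y ⇔ Adjacent S (π x) (π y)) where

  open ImageProperties π

  independent-pullback : ∀ {A B} → (∀ {x} → x ∈ A → π x ∈ B) → Independent S B → Independent R A
  independent-pullback A→B B-ind x x′ x∈A x′∈A x~x′ =
    B-ind (π x) (π x′) (A→B x∈A) (A→B x′∈A) (to (adjacent⇔ x x′) x~x′)

  independent-pushforward : ∀ {A B} → (∀ {y} → y ∈ B → ∃ λ x → x ∈ A × π x ≡ y) →
                            Independent R A → Independent S B
  independent-pushforward B→A A-ind y y′ y∈B y′∈B y~y′ with B→A y∈B | B→A y′∈B
  ... | x , x∈A , refl | x′ , x′∈A , refl = A-ind x x′ x∈A x′∈A (from (adjacent⇔ x x′) y~y′)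

  lift-preimage : ∀ {B y} → y ∈ B → ∃ λ x → x ∈ preimage π B × π x ≡ y
  lift-preimage {B} {y} y∈B with π-surjective y
  ... | x , refl = x , ∈-preimage⁺ y∈B , refl

  maximalIndependent⇔preimage : ∀ B → MaximalIndependent S B ⇔ MaximalIndependent R (preimage π B)
  maximalIndependent⇔preimage B = mk⇔ pullback pushforward
    where
    pullback : MaximalIndependent S B → MaximalIndependent R (preimage π B)
    pullback (B-ind , B-max) = independent-pullback ∈-preimage⁻ B-ind , preimage-max
      where
      preimage-max : ∀ C → Independent R C → preimage π B ⊆ C → C ⊆ preimage π B
      preimage-max C C-ind preimage⊆C x∈C =
        ∈-preimage⁺ (B-max (image π C) (independent-pushforward ∈-image⁻ C-ind) B⊆image
                           (∈-image⁺ x∈C))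
        where
        B⊆image : B ⊆ image π C
        B⊆image y∈B with lift-preimage y∈B
        ... | x , x∈preimage , refl = ∈-image⁺ (preimage⊆C x∈preimage)

    pushforward : MaximalIndependent R (preimage π B) → MaximalIndependent S B
    pushforward (P-ind , P-max) = independent-pushforward lift-preimage P-ind , B-max
      where
      B-max : ∀ C → Independent S C → B ⊆ C → C ⊆ B
      B-max C C-ind B⊆C y∈C with lift-preimage y∈C
      ... | x , x∈preimage , refl =
        ∈-preimage⁻ (P-max (preimage π C) (independent-pullback ∈-preimage⁻ C-ind)
                           (λ x∈P → ∈-preimage⁺ (B⊆C (∈-preimage⁻ x∈P))) x∈preimage)

  maximalIndependent⇒saturated : ∀ {A} → MaximalIndependent R A → A ≡ preimage π (image π A)
  maximalIndependent⇒saturated {A} (A-ind , A-max) =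
    ⊆-antisym A⊆saturation (A-max _ saturation-ind A⊆saturation)
    where
    saturation-ind : Independent R (preimage π (image π A))
    saturation-ind = independent-pullback ∈-preimage⁻ (independent-pushforward ∈-image⁻ A-ind)

    A⊆saturation : A ⊆ preimage π (image π A)
    A⊆saturation x∈A = ∈-preimage⁺ (∈-image⁺ x∈A)

  maximalIndependent⇒image : ∀ {A} → MaximalIndependent R A → MaximalIndependent S (image π A)
  maximalIndependent⇒image {A} A-max =
    from (maximalIndependent⇔preimage (image π A))
         (subst (MaximalIndependent R) (maximalIndependent⇒saturated A-max) A-max)

  wellCovered⇔ : ∀ c .{{_ : NonZero c}} → (∀ B → ∣ preimage π B ∣ ≡ c ℕ.* ∣ B ∣) →
                 WellCovered R ⇔ WellCovered S
  wellCovered⇔ c ∣preimage∣ = mk⇔ R→S S→R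
    where
    ∣maximal∣ : ∀ {A} → MaximalIndependent R A → ∣ A ∣ ≡ c ℕ.* ∣ image π A ∣
    ∣maximal∣ A-max = trans (cong ∣_∣ (maximalIndependent⇒saturated A-max)) (∣preimage∣ (image π _))

    R→S : WellCovered R → WellCovered S
    R→S R-wc B B′ B-max B′-max = ℕₚ.*-cancelˡ-≡ ∣ B ∣ ∣ B′ ∣ c
      (trans (sym (∣preimage∣ B))
        (trans (R-wc _ _ (to (maximalIndependent⇔preimage B) B-max)
                         (to (maximalIndependent⇔preimage B′) B′-max))
               (∣preimage∣ B′)))

    S→R : WellCovered S → WellCovered R
    S→R S-wc A A′ A-max A′-max =
      trans (∣maximal∣ A-max)
        (trans (cong (c ℕ.*_) (S-wc _ _ (maximalIndependent⇒image A-max)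
                                        (maximalIndependent⇒image A′-max)))
               (sym (∣maximal∣ A′-max)))

proposition3p1 : ∀ {n m} (R : FiniteRing n) (S : FiniteRing m)
    (J : Subset n) (π : Fin n → Fin m) →
    IsJacobsonRadical R J →
    IsQuotientBy R S π J →
    (∀ A → MaximalIndependent R A ⇔ (MaximalIndependent S (image π A) × (A ≡ _⊕_ R A J)))
    × (∀ A → MaximalIndependent S (image π A) ⇔ MaximalIndependent R (_⊕_ R A J))
    × (WellCovered R ⇔ WellCovered S)
proposition3p1 R S J π J-radical (π-hom , π-surjective , π-kernel) =
  (λ A → mk⇔
    (λ A-max → maximalIndependent⇒image A-max
             , trans (maximalIndependent⇒saturated A-max) (sym (A⊕J≡saturation A)))
    (λ (Ā-max , A≡A⊕J) → subst (MaximalIndependent R) (sym A≡A⊕J) (to (Ā-max⇔A⊕J-max A) Ā-max)))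
  , Ā-max⇔A⊕J-max
  , wellCovered⇔ (fibre π (FiniteRing.0# S)) {{fibre-nonZero}} ∣preimage∣
  where
  open SurjectiveHom R S π π-hom π-surjective
  open MaximalIndependentSets R S π π-surjective
         (adjacent⇔ λ {x} → proj₁ (J-radical x) ∘ proj₁ (π-kernel x))

  A⊕J≡saturation : ∀ A → _⊕_ R A J ≡ preimage π (image π A)
  A⊕J≡saturation = ⊕-kernel≡saturation π-kernel

  Ā-max⇔A⊕J-max : ∀ A → MaximalIndependent S (image π A) ⇔ MaximalIndependent R (_⊕_ R A J)
  Ā-max⇔A⊕J-max A =
    subst (λ X → MaximalIndependent S (image π A) ⇔ MaximalIndependent R X)
          (sym (A⊕J≡saturation A)) (maximalIndependent⇔preimage (image π A))
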